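{- For all $n\ge 5$, $\mathrm{r}_n(1423)=2\,\mathrm{r}_{n-1}(1423)+\mathrm{r}_{n-3}(1423)+2$.
   Context: $\mathcal{S}_n$ is the set of permutations of $[n]$, $\pi^r$ the reversal of $\pi$. A word $w$ contains $\rho\in\mathcal{S}_k$ if some subsequence $w_{i_1}\cdots w_{i_k}$ ($i_1<\cdots<i_k$) satisfies $w_{i_a}\le w_{i_b}$ iff $\rho_a\le\rho_b$; otherwise it avoids $\rho$. $\mathcal{R}_n=\{\pi\pi^r:\pi\in\mathcal{S}_n\}$ (concatenation of $\pi$ with its reversal), and $\mathrm{r}_n(\rho)$ is the number of members of $\mathcal{R}_n$ avoiding $\rho$. -}

module Defs where

open import Data.Nat using (ℕ; zero; suc; _≤ᵇ_)
open import Data.Bool using (Bool; true; false; not; _∧_; if_then_else_)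
open import Data.List using (List; []; _∷_; _++_; map; concatMap; length; filter; reverse; zip)
open import Data.Bool.ListAction using (all; any)
open import Relation.Nullary.Decidable using (yes; no)
open import Data.Bool.Properties using (T?)

oneTo : ℕ → List ℕ
oneTo zero = []
oneTo (suc n) = oneTo n ++ (suc n ∷ [])

insertions : ℕ → List ℕ → List (List ℕ)
insertions x [] = (x ∷ []) ∷ []
insertions x (y ∷ ys) = (x ∷ y ∷ ys) ∷ map (y ∷_) (insertions x ys)

-- all lists that are permutations of a given list (duplicate-free input gives each once)
permsOf : List ℕ → List (List ℕ)
permsOf [] = [] ∷ []
permsOf (x ∷ xs) = concatMap (insertions x) (permsOf xs)

S : ℕ → List (List ℕ)
S n = permsOf (oneTo n)

subseqs : List ℕ → List (List ℕ)
subseqs [] = [] ∷ []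
subseqs (x ∷ xs) = map (x ∷_) (subseqs xs) ++ subseqs xs

_⇔ᵇ_ : Bool → Bool → Bool
true ⇔ᵇ b = b
false ⇔ᵇ b = not b

orderIso : List ℕ → List ℕ → Bool
orderIso u ρ = all (λ p → all (λ q → (Data.Nat._≤ᵇ_ (Data.Product.proj₁ p) (Data.Product.proj₁ q)) ⇔ᵇ (Data.Nat._≤ᵇ_ (Data.Product.proj₂ p) (Data.Product.proj₂ q))) pairs) pairs
  where
    import Data.Product
    import Data.Nat
    pairs = zip u ρ

sameLength : List ℕ → List ℕ → Bool
sameLength [] [] = true
sameLength [] (_ ∷ _) = false
sameLength (_ ∷ _) [] = false
sameLength (_ ∷ xs) (_ ∷ ys) = sameLength xs ys

contains : List ℕ → List ℕ → Bool
contains w ρ = any (λ u → sameLength u ρ ∧ orderIso u ρ) (subseqs w)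

avoids : List ℕ → List ℕ → Bool
avoids w ρ = not (contains w ρ)

R : ℕ → List (List ℕ)
R n = map (λ π → π ++ reverse π) (S n)

r : ℕ → List ℕ → ℕ
r n ρ = length (filter (λ w → T? (avoids w ρ)) (R n))

-- Every permutation of [n] arises from one of {2, …, n} by inserting the new minimum x.
-- Since x can only play the 1 of a 1423, the word σ σʳ of σ = U x D avoids 1423 exactly
-- when π πʳ (π = U D) does and D πʳ avoids 312, i.e. D is an admissible suffix of π.
-- Admissibility passes to shorter suffixes, so the admissible suffixes of a good π are the
-- tails of a longest one, Q, and following Q through an insertion shows that the classes of
-- the children of π, with multiplicities, depend only on the class of π: no admissible
-- suffix, |Q| = 1, Q a descent of length 2, or Q starting below its last entry (with |Q| + 1).
-- The class counts of the permutations of [n] therefore evolve by a linear map `step`,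
-- and two linear invariants of `step` turn three steps of it into the recurrence.

module Submission where

open import Defs
open import Data.Nat using (ℕ; _+_; _*_; _∸_; _≤_)
open import Data.List using (List; _∷_; [])
open import Relation.Binary.PropositionalEquality using (_≡_)

open import Data.Bool using (Bool; true; false; not; _∧_; T; if_then_else_)
open import Data.Bool.Properties using (T?; T-≡; T-not-≡)
open import Data.Empty using (⊥; ⊥-elim)
open import Data.List using (_++_; map; reverse; zip; length; filter; tails; foldr; concatMap; applyUpTo)
open import Data.List.Properties
  using (++-assoc; ++-identityʳ; ∷-injectiveʳ; reverse-++; unfold-reverse; map-id; map-++; map-∘; length-map; length-++;
         applyUpTo-∷ʳ; length-applyUpTo; filter-all; filter-reject; filter-none)
open import Data.List.Membership.Propositional using (_∈_; _∉_; find; lose)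
open import Data.List.Membership.Propositional.Properties using (∈-++⁺ˡ; ∈-++⁺ʳ; ∈-++⁻; ∈-map⁺; ∈-map⁻; ∈-concatMap⁻)
open import Data.List.Relation.Binary.Permutation.Propositional using (_↭_; ↭-sym; ↭-refl; ↭-trans; prep)
open import Data.List.Relation.Binary.Permutation.Propositional.Properties using (All-resp-↭; ↭-reverse; shift)
open import Data.List.Relation.Binary.Sublist.Propositional using (_⊆_; []; _∷_; _∷ʳ_; ⊆-refl; ⊆-trans; minimum; from∈; lookup)
open import Data.List.Relation.Binary.Sublist.Propositional.Properties using (++⁺; ++⁺ˡ; ++⁺ʳ; reverse⁺; ∷ˡ⁻; length-mono-≤)
open import Data.List.Relation.Unary.All as All using (All; []; _∷_)
open import Data.List.Relation.Unary.All.Properties as AllP using (all⁺) renaming (++⁺ to _++ᴬ_)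
open import Data.List.Relation.Unary.AllPairs using (AllPairs; _∷_)
open import Data.List.Relation.Unary.AllPairs.Properties using (applyUpTo⁺₁)
open import Data.List.Relation.Unary.Any using (here; there)
open import Data.List.Relation.Unary.Any.Properties as Any using (any⁺; any⁻)
open import Data.Nat using (zero; suc; _<_; _≤ᵇ_; _<ᵇ_; s≤s; z≤n)
open import Data.Nat.Properties
  using (+-assoc; +-comm; +-identityʳ; +-cancelˡ-≡; ≤-refl; <-trans; <-irrefl; <⇒≤; <⇒≱; <⇒≯; >⇒≢; ≰⇒>;
         m≤n⇒m<n∨m≡n; ≤⇒≤ᵇ; ≤ᵇ⇒≤; <⇒<ᵇ; <ᵇ⇒<)
open import Data.Nat.Tactic.RingSolver using (solve)
open import Data.Product as Product using (_×_; _,_; -,_; proj₁; proj₂; ∃-syntax)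
open import Data.Sum as Sum using (_⊎_; inj₁; inj₂)
open import Function using (_∘_; Equivalence)
open import Relation.Binary.PropositionalEquality using (refl; sym; trans; cong; cong₂; subst; subst₂; _≢_)
open Relation.Binary.PropositionalEquality.≡-Reasoning
open import Relation.Nullary using (¬_)

private variable
  X : Set
  u v w : List X

⊆-insert : ∀ (A : List X) x {B} → A ++ B ⊆ A ++ x ∷ B
⊆-insert A x = ++⁺ (⊆-refl {x = A}) (x ∷ʳ ⊆-refl)

⊆-delete : ∀ (A : List X) {x B u} → u ⊆ A ++ x ∷ B → x ∉ u → u ⊆ A ++ B
⊆-delete []      (_ ∷ʳ p)   x∉u = p
⊆-delete []      (refl ∷ p) x∉u = ⊥-elim (x∉u (here refl))
⊆-delete (y ∷ A) (.y ∷ʳ p)  x∉u = y ∷ʳ ⊆-delete A p x∉u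
⊆-delete (y ∷ A) (refl ∷ p) x∉u = refl ∷ ⊆-delete A p (x∉u ∘ there)

⊆-delete₂ : ∀ (A B : List X) {x C u} → u ⊆ A ++ x ∷ B ++ x ∷ C → x ∉ u → u ⊆ A ++ B ++ C
⊆-delete₂ A B p x∉u =
  subst (_ ⊆_) (++-assoc A B _)
    (⊆-delete (A ++ B) (subst (_ ⊆_) (sym (++-assoc A B _)) (⊆-delete A p x∉u)) x∉u)

∷⊆-first : ∀ (L : List X) {x v M} → x ∷ v ⊆ L ++ x ∷ M → x ∉ L → v ⊆ M
∷⊆-first []      (_ ∷ʳ p)   x∉L = ∷ˡ⁻ p
∷⊆-first []      (refl ∷ p) x∉L = p
∷⊆-first (y ∷ L) (.y ∷ʳ p)  x∉L = ∷⊆-first L p (x∉L ∘ there)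
∷⊆-first (y ∷ L) (refl ∷ p) x∉L = ⊥-elim (x∉L (here refl))

∷∷⊆-split : ∀ (L : List X) {c x v M} → c ∷ x ∷ v ⊆ L ++ x ∷ M → c ≢ x → x ∉ L →
            (c ∈ L × v ⊆ M) ⊎ c ∷ x ∷ v ⊆ M
∷∷⊆-split []      (_ ∷ʳ p)   c≢x x∉L = inj₂ p
∷∷⊆-split []      (refl ∷ p) c≢x x∉L = ⊥-elim (c≢x refl)
∷∷⊆-split (y ∷ L) (.y ∷ʳ p)  c≢x x∉L = Sum.map₁ (Product.map₁ there) (∷∷⊆-split L p c≢x (x∉L ∘ there))
∷∷⊆-split (y ∷ L) (refl ∷ p) c≢x x∉L = inj₁ (here refl , ∷⊆-first L p (x∉L ∘ there))

∈-reverse⁻ : ∀ {y : X} L → y ∈ reverse L → y ∈ L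
∈-reverse⁻ L = Any.reverse⁻

∈-++-reverse⁻ : ∀ {y : X} D → y ∈ D ++ reverse D → y ∈ D
∈-++-reverse⁻ D y∈ with ∈-++⁻ D y∈
... | inj₁ y∈D = y∈D
... | inj₂ y∈D = ∈-reverse⁻ D y∈D

All-reverse : ∀ {P : X → Set} {L} → All P L → All P (reverse L)
All-reverse {L = L} = All-resp-↭ (↭-sym (↭-reverse L))

<-∉ : ∀ {x L} → All (x <_) L → x ∉ L
<-∉ x<L x∈L = <-irrefl refl (All.lookup x<L x∈L)

-- Occurrences of 312 and 1423

data Occ312 (w : List ℕ) : Set where
  occ312 : ∀ {c a b} → c ∷ a ∷ b ∷ [] ⊆ w → a < b → b < c → Occ312 w

data Occ1423 (w : List ℕ) : Set where
  occ1423 : ∀ {a d b c} → a ∷ d ∷ b ∷ c ∷ [] ⊆ w → a < b → b < c → c < d → Occ1423 w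

Occ312-mono : v ⊆ w → Occ312 v → Occ312 w
Occ312-mono v⊆w (occ312 p a<b b<c) = occ312 (⊆-trans p v⊆w) a<b b<c

Occ1423-mono : v ⊆ w → Occ1423 v → Occ1423 w
Occ1423-mono v⊆w (occ1423 p a<b b<c c<d) = occ1423 (⊆-trans p v⊆w) a<b b<c c<d

∈-subseqs⁺ : u ⊆ w → u ∈ subseqs w
∈-subseqs⁺ []                   = here refl
∈-subseqs⁺ {w = y ∷ w} (y ∷ʳ p) = ∈-++⁺ʳ (map (y ∷_) (subseqs w)) (∈-subseqs⁺ p)
∈-subseqs⁺ (refl ∷ p)           = ∈-++⁺ˡ (∈-map⁺ (_ ∷_) (∈-subseqs⁺ p))

∈-subseqs⁻ : ∀ w → u ∈ subseqs w → u ⊆ w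
∈-subseqs⁻ []      (here refl) = []
∈-subseqs⁻ (y ∷ w) u∈ with ∈-++⁻ (map (y ∷_) (subseqs w)) u∈
... | inj₂ u∈′ = y ∷ʳ ∈-subseqs⁻ w u∈′
... | inj₁ u∈′ with ∈-map⁻ (y ∷_) u∈′
...   | _ , u′∈ , refl = refl ∷ ∈-subseqs⁻ w u′∈

Matches : List ℕ → List ℕ → Set
Matches ρ u = T (sameLength u ρ ∧ orderIso u ρ)

contains⁻ : ∀ w ρ → T (contains w ρ) → ∃[ u ] (u ⊆ w × Matches ρ u)
contains⁻ w ρ t with find (any⁻ _ (subseqs w) t)
... | u , u∈ , m = u , ∈-subseqs⁻ w u∈ , m

contains⁺ : ∀ ρ → u ⊆ w → Matches ρ u → T (contains w ρ)
contains⁺ ρ p m = any⁺ _ (lose (∈-subseqs⁺ p) m)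

orderIso⁻ : ∀ u ρ {p q} → T (orderIso u ρ) → p ∈ zip u ρ → q ∈ zip u ρ →
            T ((proj₁ p ≤ᵇ proj₁ q) ⇔ᵇ (proj₂ p ≤ᵇ proj₂ q))
orderIso⁻ _ _ t p∈ q∈ = All.lookup (all⁺ _ _ (All.lookup (all⁺ _ _ t) p∈)) q∈

T-not⇒¬T : ∀ {b} → T (not b) → ¬ T b
T-not⇒¬T {false} _ ()

¬T⇒T-not : ∀ {b} → ¬ T b → T (not b)
¬T⇒T-not {true}  ¬t = ¬t _
¬T⇒T-not {false} _  = _

⇔ᵇ-false⇒> : ∀ {m n} → T ((m ≤ᵇ n) ⇔ᵇ false) → n < m
⇔ᵇ-false⇒> {m} {n} t = ≰⇒> (λ m≤n → not-T (m ≤ᵇ n) t (≤⇒≤ᵇ m≤n))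
  where
    not-T : ∀ b → T (b ⇔ᵇ false) → ¬ T b
    not-T false _ ()

<⇒≤ᵇ≡true : ∀ {m n} → m < n → (m ≤ᵇ n) ≡ true
<⇒≤ᵇ≡true = Equivalence.to T-≡ ∘ ≤⇒≤ᵇ ∘ <⇒≤

>⇒≤ᵇ≡false : ∀ {m n} → n < m → (m ≤ᵇ n) ≡ false
>⇒≤ᵇ≡false {m} {n} n<m = Equivalence.to T-not-≡ (¬T⇒T-not (<⇒≱ n<m ∘ ≤ᵇ⇒≤ m n))

≤ᵇ-refl : ∀ m → (m ≤ᵇ m) ≡ true
≤ᵇ-refl m = Equivalence.to T-≡ (≤⇒≤ᵇ (≤-refl {m}))

>⇒<ᵇ≡false : ∀ {m n} → n < m → (m <ᵇ n) ≡ false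
>⇒<ᵇ≡false {m} {n} n<m = Equivalence.to T-not-≡ (¬T⇒T-not (<⇒≯ n<m ∘ <ᵇ⇒< m n))

ρ312 ρ1423 : List ℕ
ρ312  = 3 ∷ 1 ∷ 2 ∷ []
ρ1423 = 1 ∷ 4 ∷ 2 ∷ 3 ∷ []

contains312⁻ : ∀ {w} → T (contains w ρ312) → Occ312 w
contains312⁻ {w} t with contains⁻ w ρ312 t
... | c ∷ a ∷ b ∷ [] , p , m = occ312 p (⇔ᵇ-false⇒> (iso b∈ a∈)) (⇔ᵇ-false⇒> (iso c∈ b∈))
  where
    iso : ∀ {p q} → p ∈ zip (c ∷ a ∷ b ∷ []) ρ312 → q ∈ zip (c ∷ a ∷ b ∷ []) ρ312 →
          T ((proj₁ p ≤ᵇ proj₁ q) ⇔ᵇ (proj₂ p ≤ᵇ proj₂ q))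
    iso = orderIso⁻ (c ∷ a ∷ b ∷ []) ρ312 m
    c∈ = here refl
    a∈ = there (here refl)
    b∈ = there (there (here refl))

-- Once every comparison between the entries is decided, the Boolean test computes to true.
contains312⁺ : ∀ {w} → Occ312 w → T (contains w ρ312)
contains312⁺ (occ312 {c} {a} {b} p a<b b<c) = contains⁺ ρ312 p matches
  where
    matches : Matches ρ312 (c ∷ a ∷ b ∷ [])
    matches rewrite ≤ᵇ-refl a | ≤ᵇ-refl b | ≤ᵇ-refl c
                  | <⇒≤ᵇ≡true a<b | >⇒≤ᵇ≡false a<b | <⇒≤ᵇ≡true b<c | >⇒≤ᵇ≡false b<c
                  | <⇒≤ᵇ≡true (<-trans a<b b<c) | >⇒≤ᵇ≡false (<-trans a<b b<c) = _

contains1423⁻ : ∀ {w} → T (contains w ρ1423) → Occ1423 w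
contains1423⁻ {w} t with contains⁻ w ρ1423 t
... | a ∷ d ∷ b ∷ c ∷ [] , p , m =
  occ1423 p (⇔ᵇ-false⇒> (iso b∈ a∈)) (⇔ᵇ-false⇒> (iso c∈ b∈)) (⇔ᵇ-false⇒> (iso d∈ c∈))
  where
    iso : ∀ {p q} → p ∈ zip (a ∷ d ∷ b ∷ c ∷ []) ρ1423 → q ∈ zip (a ∷ d ∷ b ∷ c ∷ []) ρ1423 →
          T ((proj₁ p ≤ᵇ proj₁ q) ⇔ᵇ (proj₂ p ≤ᵇ proj₂ q))
    iso = orderIso⁻ (a ∷ d ∷ b ∷ c ∷ []) ρ1423 m
    a∈ = here refl
    d∈ = there (here refl)
    b∈ = there (there (here refl))
    c∈ = there (there (there (here refl)))

contains1423⁺ : ∀ {w} → Occ1423 w → T (contains w ρ1423)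
contains1423⁺ (occ1423 {a} {d} {b} {c} p a<b b<c c<d) = contains⁺ ρ1423 p matches
  where
    a<c = <-trans a<b b<c
    b<d = <-trans b<c c<d
    a<d = <-trans a<c c<d
    matches : Matches ρ1423 (a ∷ d ∷ b ∷ c ∷ [])
    matches rewrite ≤ᵇ-refl a | ≤ᵇ-refl b | ≤ᵇ-refl c | ≤ᵇ-refl d
                  | <⇒≤ᵇ≡true a<b | >⇒≤ᵇ≡false a<b | <⇒≤ᵇ≡true b<c | >⇒≤ᵇ≡false b<c
                  | <⇒≤ᵇ≡true c<d | >⇒≤ᵇ≡false c<d | <⇒≤ᵇ≡true a<c | >⇒≤ᵇ≡false a<c
                  | <⇒≤ᵇ≡true b<d | >⇒≤ᵇ≡false b<d | <⇒≤ᵇ≡true a<d | >⇒≤ᵇ≡false a<d = _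

-- Inserting a new minimum

Bad Good : List ℕ → Set
Bad π  = Occ1423 (π ++ reverse π)
Good π = ¬ Bad π

Admissible : List ℕ → List ℕ → Set
Admissible π D = ¬ Occ312 (D ++ reverse π)

admissible-suffix : ∀ π Z D → Admissible π (Z ++ D) → Admissible π D
admissible-suffix π Z D adm = adm ∘ Occ312-mono (subst (_ ⊆_) (sym (++-assoc Z D (reverse π))) (++⁺ˡ Z ⊆-refl))

admissible-[] : ∀ π Q → Admissible π Q → Admissible π []
admissible-[] π Q adm = adm ∘ Occ312-mono (++⁺ˡ Q ⊆-refl)

suffix-insert : ∀ E U (x : ℕ) D → (E ++ x ∷ D) ++ reverse (U ++ x ∷ D) ≡ E ++ x ∷ (D ++ reverse D) ++ x ∷ reverse U
suffix-insert E U x D = begin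
  (E ++ x ∷ D) ++ reverse (U ++ x ∷ D)             ≡⟨ ++-assoc E (x ∷ D) _ ⟩
  E ++ x ∷ D ++ reverse (U ++ x ∷ D)               ≡⟨ cong (λ r → E ++ x ∷ D ++ r) (reverse-++ U (x ∷ D)) ⟩
  E ++ x ∷ D ++ reverse (x ∷ D) ++ reverse U       ≡⟨ cong (λ r → E ++ x ∷ D ++ r ++ reverse U) (unfold-reverse x D) ⟩
  E ++ x ∷ D ++ (reverse D ++ x ∷ []) ++ reverse U ≡⟨ cong (λ r → E ++ x ∷ D ++ r) (++-assoc (reverse D) (x ∷ []) (reverse U)) ⟩
  E ++ x ∷ D ++ reverse D ++ x ∷ reverse U         ≡⟨ cong (λ r → E ++ x ∷ r) (sym (++-assoc D (reverse D) _)) ⟩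
  E ++ x ∷ (D ++ reverse D) ++ x ∷ reverse U       ∎

suffix-split : ∀ (E U D : List ℕ) → (E ++ D) ++ reverse (U ++ D) ≡ E ++ (D ++ reverse D) ++ reverse U
suffix-split E U D = begin
  (E ++ D) ++ reverse (U ++ D)       ≡⟨ ++-assoc E D _ ⟩
  E ++ D ++ reverse (U ++ D)         ≡⟨ cong (λ r → E ++ D ++ r) (reverse-++ U D) ⟩
  E ++ D ++ reverse D ++ reverse U   ≡⟨ cong (E ++_) (sym (++-assoc D (reverse D) (reverse U))) ⟩
  E ++ (D ++ reverse D) ++ reverse U ∎

word-≥ : ∀ {x} E U D → All (x <_) E → All (x <_) (U ++ D) → All (x ≤_) (E ++ x ∷ (D ++ reverse D) ++ x ∷ reverse U)
word-≥ E U D x<E x<π =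
  All.map <⇒≤ x<E ++ᴬ (≤-refl ∷ (All.map <⇒≤ (x<D ++ᴬ All-reverse x<D) ++ᴬ (≤-refl ∷ All.map <⇒≤ (All-reverse x<U))))
  where
    x<U = AllP.++⁻ˡ U x<π
    x<D = AllP.++⁻ʳ U x<π

-- An occurrence avoiding x survives deleting both copies of x; one starting with x leaves a
-- 312 in D ++ reverse π.
insert-good : ∀ U D {π σ x} → π ≡ U ++ D → σ ≡ U ++ x ∷ D → All (x <_) π → Good π → Admissible π D → Good σ
insert-good U D {x = x} refl refl x<π good adm (occ1423 {a} {d} {b} {c} p a<b b<c c<d)
  with p′ ← subst (_ ⊆_) (suffix-insert U U x D) p
  with m≤n⇒m<n∨m≡n (All.lookup (word-≥ U U D (AllP.++⁻ˡ U x<π) x<π) (lookup p′ (here refl)))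
... | inj₁ x<a = good (occ1423 (subst (_ ⊆_) (sym (suffix-split U U D)) (⊆-delete₂ U (D ++ reverse D) p′ x∉)) a<b b<c c<d)
  where
    x<b = <-trans x<a a<b
    x<c = <-trans x<b b<c
    x∉ = <-∉ (x<a ∷ <-trans x<c c<d ∷ x<b ∷ x<c ∷ [])
... | inj₂ refl = adm (occ312 (subst (_ ⊆_) (sym (suffix-split [] U D)) (⊆-delete (D ++ reverse D) dbc⊆ x∉)) b<c c<d)
  where
    x<b = a<b
    x<c = <-trans x<b b<c
    dbc⊆ = ∷⊆-first U p′ (<-∉ (AllP.++⁻ˡ U x<π))
    x∉ = <-∉ (<-trans x<c c<d ∷ x<b ∷ x<c ∷ [])

reverse-insert-⊆ : ∀ U (x : ℕ) D → reverse (U ++ D) ⊆ reverse (U ++ x ∷ D)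
reverse-insert-⊆ U x D = reverse⁺ (⊆-insert U x)

bad-insert : ∀ U D {π σ x} → π ≡ U ++ D → σ ≡ U ++ x ∷ D → Bad π → Bad σ
bad-insert U D {x = x} refl refl = Occ1423-mono (subst₂ _⊆_ (sym (suffix-split U U D)) (sym (suffix-insert U U x D)) ⊆)
  where ⊆ = ++⁺ (⊆-refl {x = U}) (x ∷ʳ ++⁺ (⊆-refl {x = D ++ reverse D}) (x ∷ʳ ⊆-refl))

inadmissible-insert : ∀ U D {π σ x} → π ≡ U ++ D → σ ≡ U ++ x ∷ D → All (x <_) π → Occ312 (D ++ reverse π) → Bad σ
inadmissible-insert U D {x = x} refl refl x<π (occ312 {c} {a} {b} p a<b b<c) =
  occ1423 (subst (_ ⊆_) (sym (++-assoc U (x ∷ D) _)) (++⁺ˡ U (refl ∷ ⊆-trans p (++⁺ ⊆-refl (reverse-insert-⊆ U x D)))))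
          x<a a<b b<c
  where
    x<a = All.lookup (AllP.++⁻ʳ U x<π ++ᴬ All-reverse x<π) (lookup p (there (here refl)))

∈-tail-word⁻ : ∀ {y : ℕ} U x D → y ∈ (D ++ reverse D) ++ x ∷ reverse U → y ≡ x ⊎ y ∈ U ++ D
∈-tail-word⁻ U x D y∈ with ∈-++⁻ (D ++ reverse D) y∈
... | inj₁ y∈DD        = inj₂ (∈-++⁺ʳ U (∈-++-reverse⁻ D y∈DD))
... | inj₂ (here refl) = inj₁ refl
... | inj₂ (there y∈U) = inj₂ (∈-++⁺ˡ (∈-reverse⁻ U y∈U))

-- If x is the 1 of the 312, its 3 lies in E and its 2 in π, or its 3 in D and its 2 in U.
x-not-middle : ∀ {x c b} E U D → All (x <_) (U ++ D) → All (x <_) E →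
               (∀ {c b} → c ∈ E → b ∈ U ++ D → c ≤ b) → (∀ {c b} → c ∈ D → b ∈ U → c ≤ b) →
               c ∷ x ∷ b ∷ [] ⊆ E ++ x ∷ (D ++ reverse D) ++ x ∷ reverse U → x < b → b < c → ⊥
x-not-middle E U D x<π x<E E≤π D≤U p x<b b<c with ∷∷⊆-split E p (>⇒≢ (<-trans x<b b<c)) (<-∉ x<E)
... | inj₁ (c∈E , b⊆) with ∈-tail-word⁻ U _ D (lookup b⊆ (here refl))
...   | inj₁ refl = <-irrefl refl x<b
...   | inj₂ b∈π  = <⇒≱ b<c (E≤π c∈E b∈π)
x-not-middle E U D x<π x<E E≤π D≤U p x<b b<c | inj₂ p′
  with ∷∷⊆-split (D ++ reverse D) p′ (>⇒≢ (<-trans x<b b<c)) (<-∉ (x<D ++ᴬ All-reverse x<D))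
  where x<D = AllP.++⁻ʳ U x<π
... | inj₁ (c∈DD , b⊆) = <⇒≱ b<c (D≤U (∈-++-reverse⁻ D c∈DD) (∈-reverse⁻ U (lookup b⊆ (here refl))))
... | inj₂ p″ = <-∉ (All-reverse (AllP.++⁻ˡ U x<π)) (lookup p″ (there (here refl)))

admissible-insert : ∀ E U D {π σ x} → π ≡ U ++ D → σ ≡ U ++ x ∷ D → All (x <_) π → All (x <_) E →
                    Admissible π (E ++ D) →
                    (∀ {c b} → c ∈ E → b ∈ π → c ≤ b) → (∀ {c b} → c ∈ D → b ∈ U → c ≤ b) →
                    Admissible σ (E ++ x ∷ D)
admissible-insert E U D {x = x} refl refl x<π x<E adm E≤π D≤U (occ312 {c} {a} {b} p a<b b<c)
  with p′ ← subst (_ ⊆_) (suffix-insert E U x D) p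
  with m≤n⇒m<n∨m≡n (All.lookup (word-≥ E U D x<E x<π) (lookup p′ (there (here refl))))
... | inj₁ x<a = adm (occ312 (subst (_ ⊆_) (sym (suffix-split E U D)) (⊆-delete₂ E (D ++ reverse D) p′ x∉)) a<b b<c)
  where x∉ = <-∉ (<-trans x<a (<-trans a<b b<c) ∷ x<a ∷ <-trans x<a a<b ∷ [])
... | inj₂ refl = x-not-middle E U D x<π x<E E≤π D≤U p′ a<b b<c

reverse-312 : ∀ {σ x u v} → u ∷ x ∷ v ∷ [] ⊆ σ → x < u → u < v → Occ312 (reverse σ)
reverse-312 p x<u u<v = occ312 (reverse⁺ p) x<u u<v

insertionsBefore : ℕ → List ℕ → List (List ℕ)
insertionsBefore x []      = []
insertionsBefore x (y ∷ P) = (x ∷ y ∷ P) ∷ map (y ∷_) (insertionsBefore x P)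

∈-insertions⁻ : ∀ x π {σ} → σ ∈ insertions x π → ∃[ U ] ∃[ D ] (π ≡ U ++ D × σ ≡ U ++ x ∷ D)
∈-insertions⁻ x []      (here refl) = [] , [] , refl , refl
∈-insertions⁻ x (y ∷ π) (here refl) = [] , y ∷ π , refl , refl
∈-insertions⁻ x (y ∷ π) (there σ∈) with ∈-map⁻ (y ∷_) σ∈
... | τ , τ∈ , refl with ∈-insertions⁻ x π τ∈
...   | U , D , refl , refl = y ∷ U , D , refl , refl

∈-insertionsBefore⁻ : ∀ x P {σ} → σ ∈ insertionsBefore x P →
                      ∃[ U ] ∃[ y ] ∃[ D ] (P ≡ U ++ y ∷ D × σ ≡ U ++ x ∷ y ∷ D)
∈-insertionsBefore⁻ x (y ∷ P) (here refl) = [] , y , P , refl , refl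
∈-insertionsBefore⁻ x (y ∷ P) (there σ∈) with ∈-map⁻ (y ∷_) σ∈
... | τ , τ∈ , refl with ∈-insertionsBefore⁻ x P τ∈
...   | U , z , D , refl , refl = y ∷ U , z , D , refl , refl

length-insertions : ∀ x π → length (insertions x π) ≡ suc (length π)
length-insertions x []      = refl
length-insertions x (y ∷ π) = cong suc (trans (length-map (y ∷_) (insertions x π)) (length-insertions x π))

map-∷-++ : ∀ (y : X) Q Ls → map (y ∷_) (map (_++ Q) Ls) ≡ map (_++ Q) (map (y ∷_) Ls)
map-∷-++ y Q Ls = trans (sym (map-∘ Ls)) (map-∘ Ls)

insertions-++ : ∀ x P Q → insertions x (P ++ Q) ≡ map (_++ Q) (insertionsBefore x P) ++ map (P ++_) (insertions x Q)
insertions-++ x []      Q = sym (map-id (insertions x Q))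
insertions-++ x (y ∷ P) Q = cong ((x ∷ y ∷ P ++ Q) ∷_) (begin
  map (y ∷_) (insertions x (P ++ Q))
    ≡⟨ cong (map (y ∷_)) (insertions-++ x P Q) ⟩
  map (y ∷_) (map (_++ Q) (insertionsBefore x P) ++ map (P ++_) (insertions x Q))
    ≡⟨ map-++ (y ∷_) (map (_++ Q) (insertionsBefore x P)) (map (P ++_) (insertions x Q)) ⟩
  map (y ∷_) (map (_++ Q) (insertionsBefore x P)) ++ map (y ∷_) (map (P ++_) (insertions x Q))
    ≡⟨ cong₂ _++_ (map-∷-++ y Q (insertionsBefore x P)) (sym (map-∘ (insertions x Q))) ⟩
  map (_++ Q) (map (y ∷_) (insertionsBefore x P)) ++ map ((y ∷ P) ++_) (insertions x Q) ∎)

insertions-∷ʳ : ∀ x L l → insertions x (L ++ l ∷ []) ≡ map (_++ l ∷ []) (insertions x L) ++ (L ++ l ∷ x ∷ []) ∷ []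
insertions-∷ʳ x []      l = refl
insertions-∷ʳ x (y ∷ L) l = cong ((x ∷ y ∷ L ++ l ∷ []) ∷_) (begin
  map (y ∷_) (insertions x (L ++ l ∷ []))
    ≡⟨ cong (map (y ∷_)) (insertions-∷ʳ x L l) ⟩
  map (y ∷_) (map (_++ l ∷ []) (insertions x L) ++ (L ++ l ∷ x ∷ []) ∷ [])
    ≡⟨ map-++ (y ∷_) (map (_++ l ∷ []) (insertions x L)) ((L ++ l ∷ x ∷ []) ∷ []) ⟩
  map (y ∷_) (map (_++ l ∷ []) (insertions x L)) ++ (y ∷ L ++ l ∷ x ∷ []) ∷ []
    ≡⟨ cong (_++ (y ∷ L ++ l ∷ x ∷ []) ∷ []) (map-∷-++ y (l ∷ []) (insertions x L)) ⟩
  map (_++ l ∷ []) (map (y ∷_) (insertions x L)) ++ (y ∷ L ++ l ∷ x ∷ []) ∷ [] ∎)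

ascent-insertions : ∀ x P q Qm l →
  map (P ++_) (map (q ∷_) (insertions x (Qm ++ l ∷ []))) ≡
  map (λ τ → P ++ q ∷ τ ++ l ∷ []) (insertions x Qm) ++ (P ++ q ∷ Qm ++ l ∷ x ∷ []) ∷ []
ascent-insertions x P q Qm l = begin
  map (P ++_) (map (q ∷_) (insertions x (Qm ++ l ∷ [])))
    ≡⟨ sym (map-∘ (insertions x (Qm ++ l ∷ []))) ⟩
  map (λ τ → P ++ q ∷ τ) (insertions x (Qm ++ l ∷ []))
    ≡⟨ cong (map (λ τ → P ++ q ∷ τ)) (insertions-∷ʳ x Qm l) ⟩
  map (λ τ → P ++ q ∷ τ) (map (_++ l ∷ []) (insertions x Qm) ++ (Qm ++ l ∷ x ∷ []) ∷ [])
    ≡⟨ map-++ (λ τ → P ++ q ∷ τ) (map (_++ l ∷ []) (insertions x Qm)) ((Qm ++ l ∷ x ∷ []) ∷ []) ⟩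
  map (λ τ → P ++ q ∷ τ) (map (_++ l ∷ []) (insertions x Qm)) ++ (P ++ q ∷ Qm ++ l ∷ x ∷ []) ∷ []
    ≡⟨ cong (_++ (P ++ q ∷ Qm ++ l ∷ x ∷ []) ∷ []) (sym (map-∘ (insertions x Qm))) ⟩
  map (λ τ → P ++ q ∷ τ ++ l ∷ []) (insertions x Qm) ++ (P ++ q ∷ Qm ++ l ∷ x ∷ []) ∷ [] ∎

∈-permsOf⇒↭ : ∀ L {π} → π ∈ permsOf L → π ↭ L
∈-permsOf⇒↭ []      (here refl) = ↭-refl
∈-permsOf⇒↭ (x ∷ L) σ∈ with find (∈-concatMap⁻ (insertions x) {xs = permsOf L} σ∈)
... | π , π∈ , σ∈π with ∈-insertions⁻ x π σ∈π
...   | U , D , refl , refl = ↭-trans (shift x U D) (prep x (∈-permsOf⇒↭ L π∈))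

-- Longest admissible suffixes

last-∈-suffix : ∀ (P U : List X) {u y D} → P ++ u ∷ [] ≡ U ++ y ∷ D → u ∈ y ∷ D
last-∈-suffix P       []          eq   = subst (_ ∈_) eq (∈-++⁺ʳ P (here refl))
last-∈-suffix (_ ∷ P) (_ ∷ U)     eq   = last-∈-suffix P U (∷-injectiveʳ eq)
last-∈-suffix []      (_ ∷ [])    ()
last-∈-suffix []      (_ ∷ _ ∷ _) ()

record MaxAdmissible (π P Q : List ℕ) : Set where
  field
    split      : π ≡ P ++ Q
    below      : ∀ {p q} → p ∈ P → q ∈ Q → q < p
    good       : Good π
    admissible : Admissible π Q
    maximal    : ∀ {U y D} → P ≡ U ++ y ∷ D → Occ312 ((y ∷ D ++ Q) ++ reverse π)

singleton-maximal : ∀ x → MaxAdmissible (x ∷ []) [] (x ∷ [])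
singleton-maximal x = record
  { split      = refl
  ; below      = λ ()
  ; good       = λ { (occ1423 p _ _ _) → too-long (length-mono-≤ p) }
  ; admissible = λ { (occ312 p _ _) → too-long (length-mono-≤ p) }
  ; maximal    = λ { {[]} () ; {_ ∷ _} () }
  }
  where
    too-long : ∀ {n} → 3 + n ≤ 2 → ⊥
    too-long (s≤s (s≤s ()))

insert-front : ∀ {π P Q x} → MaxAdmissible π P Q → All (x <_) π → MaxAdmissible (P ++ x ∷ Q) P (x ∷ Q)
insert-front {P = P} {Q} {x} M x<π with refl ← MaxAdmissible.split M = record
  { split      = refl
  ; below      = λ { p∈ (here refl) → All.lookup x<π (∈-++⁺ˡ p∈) ; p∈ (there q∈) → below p∈ q∈ }
  ; good       = insert-good P Q refl refl x<π good admissible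
  ; admissible = admissible-insert [] P Q refl refl x<π [] admissible (λ ()) (λ q∈ p∈ → <⇒≤ (below p∈ q∈))
  ; maximal    = λ eq → Occ312-mono (++⁺ (refl ∷ ⊆-insert _ x) (reverse-insert-⊆ P x Q)) (maximal eq)
  }
  where open MaxAdmissible M

append-after-ascent : ∀ {π x q Z l} → Good π → Admissible π [] → All (x <_) π → q ∈ π → π ≡ Z ++ l ∷ [] → q < l →
                      MaxAdmissible (π ++ x ∷ []) π (x ∷ [])
append-after-ascent {π} {x} {Z = Z} good adm x<π q∈π refl q<l = record
  { split      = refl
  ; below      = λ { p∈ (here refl) → All.lookup x<π p∈ }
  ; good       = insert-good π [] (sym (++-identityʳ π)) refl x<π good adm
  ; admissible = admissible-insert [] π [] (sym (++-identityʳ π)) refl x<π [] adm (λ ()) (λ ())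
  ; maximal    = λ {U} eq → occ312 (++⁺ (++⁺ (from∈ (last-∈-suffix Z U eq)) (refl ∷ [])) (from∈ (Any.reverse⁺ (∈-++⁺ˡ q∈π))))
                                   (All.lookup x<π q∈π) q<l
  }

single-append : ∀ {π P q x} → MaxAdmissible π P (q ∷ []) → All (x <_) π → MaxAdmissible (P ++ q ∷ x ∷ []) P (q ∷ x ∷ [])
single-append {P = P} {q} {x} M x<π with refl ← MaxAdmissible.split M = record
  { split      = refl
  ; below      = λ { p∈ (here refl) → below p∈ (here refl) ; p∈ (there (here refl)) → All.lookup x<π (∈-++⁺ˡ p∈) }
  ; good       = insert-good π [] π≡ σ≡ x<π good (admissible-suffix π (q ∷ []) [] admissible)
  ; admissible = admissible-insert (q ∷ []) π [] π≡ σ≡ x<π (x<q ∷ []) admissible q≤π (λ ())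
  ; maximal    = λ eq → Occ312-mono (++⁺ (refl ∷ ++⁺ ⊆-refl q⊆qx) (reverse⁺ (++⁺ (⊆-refl {x = P}) q⊆qx))) (maximal eq)
  }
  where
    open MaxAdmissible M
    π  = P ++ q ∷ []
    π≡ = sym (++-identityʳ π)
    σ≡ = sym (++-assoc P (q ∷ []) (x ∷ []))
    x<q = All.lookup x<π (∈-++⁺ʳ P (here refl))
    q⊆qx : q ∷ [] ⊆ q ∷ x ∷ []
    q⊆qx = refl ∷ x ∷ʳ []
    q≤π : ∀ {c b} → c ∈ q ∷ [] → b ∈ π → c ≤ b
    q≤π (here refl) b∈ with ∈-++⁻ P b∈
    ... | inj₁ b∈P        = <⇒≤ (below b∈P (here refl))
    ... | inj₂ (here refl) = ≤-refl

descent-append : ∀ {π P u v x} → v < u → MaxAdmissible π P (u ∷ v ∷ []) → All (x <_) π →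
                 MaxAdmissible (P ++ u ∷ v ∷ x ∷ []) (P ++ u ∷ []) (v ∷ x ∷ [])
descent-append {P = P} {u} {v} {x} v<u M x<π with refl ← MaxAdmissible.split M = record
  { split      = sym (++-assoc P (u ∷ []) (v ∷ x ∷ []))
  ; below      = below′
  ; good       = insert-good π [] π≡ σ≡ x<π good (admissible-suffix π (u ∷ v ∷ []) [] admissible)
  ; admissible = admissible-insert (v ∷ []) π [] π≡ σ≡ x<π (x<v ∷ []) (admissible-suffix π (u ∷ []) (v ∷ []) admissible)
                                  v≤π (λ ())
  ; maximal    = λ {U} eq → occ312 (++⁺ (++⁺ (from∈ (last-∈-suffix P U eq)) (v ∷ʳ refl ∷ []))
                                          (from∈ (Any.reverse⁺ (∈-++⁺ʳ P (there (here refl))))))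
                                   x<v v<u
  }
  where
    open MaxAdmissible M
    π  = P ++ u ∷ v ∷ []
    π≡ = sym (++-identityʳ π)
    σ≡ = sym (++-assoc P (u ∷ v ∷ []) (x ∷ []))
    x<u = All.lookup x<π (∈-++⁺ʳ P (here refl))
    x<v = All.lookup x<π (∈-++⁺ʳ P (there (here refl)))
    below′ : ∀ {p y} → p ∈ P ++ u ∷ [] → y ∈ v ∷ x ∷ [] → y < p
    below′ p∈ y∈ with ∈-++⁻ P p∈ | y∈
    ... | inj₁ p∈P        | here refl         = below p∈P (there (here refl))
    ... | inj₁ p∈P        | there (here refl) = All.lookup x<π (∈-++⁺ˡ p∈P)
    ... | inj₂ (here refl) | here refl         = v<u
    ... | inj₂ (here refl) | there (here refl) = x<u
    v≤π : ∀ {c b} → c ∈ v ∷ [] → b ∈ π → c ≤ b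
    v≤π (here refl) b∈ with ∈-++⁻ P b∈
    ... | inj₁ b∈P                = <⇒≤ (below b∈P (there (here refl)))
    ... | inj₂ (here refl)         = <⇒≤ v<u
    ... | inj₂ (there (here refl)) = ≤-refl

descent-insert-middle : ∀ {π P u v x} → v < u → MaxAdmissible π P (u ∷ v ∷ []) → All (x <_) π →
                        MaxAdmissible (P ++ u ∷ x ∷ v ∷ []) (P ++ u ∷ []) (x ∷ v ∷ [])
descent-insert-middle {P = P} {u} {v} {x} v<u M x<π with refl ← MaxAdmissible.split M = record
  { split      = σ≡
  ; below      = below′
  ; good       = insert-good (P ++ u ∷ []) (v ∷ []) π≡ σ≡ x<π good admissible-v
  ; admissible = admissible-insert [] (P ++ u ∷ []) (v ∷ []) π≡ σ≡ x<π [] admissible-v (λ ()) v≤Pu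
  ; maximal    = λ {U} eq → occ312 (++⁺ʳ _ (++⁺ (from∈ (last-∈-suffix P U eq)) ⊆-refl)) x<v v<u
  }
  where
    open MaxAdmissible M
    π  = P ++ u ∷ v ∷ []
    π≡ = sym (++-assoc P (u ∷ []) (v ∷ []))
    σ≡ = sym (++-assoc P (u ∷ []) (x ∷ v ∷ []))
    admissible-v = admissible-suffix π (u ∷ []) (v ∷ []) admissible
    x<u = All.lookup x<π (∈-++⁺ʳ P (here refl))
    x<v = All.lookup x<π (∈-++⁺ʳ P (there (here refl)))
    below′ : ∀ {p y} → p ∈ P ++ u ∷ [] → y ∈ x ∷ v ∷ [] → y < p
    below′ p∈ y∈ with ∈-++⁻ P p∈ | y∈
    ... | inj₁ p∈P        | here refl         = All.lookup x<π (∈-++⁺ˡ p∈P)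
    ... | inj₁ p∈P        | there (here refl) = below p∈P (there (here refl))
    ... | inj₂ (here refl) | here refl         = x<u
    ... | inj₂ (here refl) | there (here refl) = v<u
    v≤Pu : ∀ {c b} → c ∈ v ∷ [] → b ∈ P ++ u ∷ [] → c ≤ b
    v≤Pu (here refl) b∈ with ∈-++⁻ P b∈
    ... | inj₁ b∈P        = <⇒≤ (below b∈P (there (here refl)))
    ... | inj₂ (here refl) = <⇒≤ v<u

-- Classes of good permutations

data Class : Set where
  bad dead single descent : Class
  ascent : ℕ → Class

data State (π : List ℕ) : Class → Set where
  bad     : Bad π → State π bad
  dead    : Good π → Occ312 (reverse π) → State π dead
  single  : ∀ {P q} → MaxAdmissible π P (q ∷ []) → State π single
  descent : ∀ {P u v} → v < u → MaxAdmissible π P (u ∷ v ∷ []) → State π descent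
  ascent  : ∀ {P q Q l} → q < l → MaxAdmissible π P (q ∷ Q ++ l ∷ []) → State π (ascent (3 + length Q))

ascent-insert-inside : ∀ {π P q Q l x} U D → q < l → MaxAdmissible π P (q ∷ Q ++ l ∷ []) → All (x <_) π → Q ≡ U ++ D →
                       State (P ++ q ∷ (U ++ x ∷ D) ++ l ∷ []) dead
ascent-insert-inside {P = P} {q} {l = l} {x} U D q<l M x<π refl with refl ← MaxAdmissible.split M =
  dead (insert-good (P ++ q ∷ U) (D ++ l ∷ []) (reassoc D) (reassoc (x ∷ D)) x<π good admissible-D)
       (reverse-312 (++⁺ˡ P (refl ∷ ++⁺ (++⁺ˡ U (refl ∷ minimum D)) (refl ∷ []))) x<q q<l)
  where
    open MaxAdmissible M
    π = P ++ q ∷ (U ++ D) ++ l ∷ []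
    reassoc : ∀ D′ → P ++ q ∷ (U ++ D′) ++ l ∷ [] ≡ (P ++ q ∷ U) ++ D′ ++ l ∷ []
    reassoc D′ = trans (cong (λ z → P ++ q ∷ z) (++-assoc U D′ (l ∷ []))) (sym (++-assoc P (q ∷ U) _))
    admissible-D = admissible-suffix π (q ∷ U) (D ++ l ∷ []) (subst (λ z → Admissible π (q ∷ z)) (++-assoc U D _) admissible)
    x<q = All.lookup x<π (∈-++⁺ʳ P (here refl))

ascent-append : ∀ {π P q Qm l x} → q < l → MaxAdmissible π P (q ∷ Qm ++ l ∷ []) → All (x <_) π →
                State (P ++ q ∷ Qm ++ l ∷ x ∷ []) single
ascent-append {P = P} {q} {Qm} {l} {x} q<l M x<π with refl ← MaxAdmissible.split M =
  subst (λ σ → State σ single) (trans (++-assoc P _ (x ∷ [])) (cong (λ z → P ++ q ∷ z) (++-assoc Qm (l ∷ []) (x ∷ []))))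
    (single (append-after-ascent good (admissible-[] (P ++ q ∷ Qm ++ l ∷ []) (q ∷ Qm ++ l ∷ []) admissible)
                                 x<π (∈-++⁺ʳ P (here refl)) (sym (++-assoc P (q ∷ Qm) (l ∷ []))) q<l))
  where open MaxAdmissible M

prefix-insertion-bad : ∀ {π P Q x σ} → MaxAdmissible π P Q → All (x <_) π → σ ∈ map (_++ Q) (insertionsBefore x P) → Bad σ
prefix-insertion-bad {P = P} {Q} {x} M x<π σ∈ with refl ← MaxAdmissible.split M | ∈-map⁻ (_++ Q) σ∈
... | τ , τ∈ , refl with ∈-insertionsBefore⁻ x P τ∈
...   | U , y , D , refl , refl =
  inadmissible-insert U (y ∷ D ++ Q) (++-assoc U (y ∷ D) Q) (++-assoc U (x ∷ y ∷ D) Q) x<π (MaxAdmissible.maximal M refl)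

admissibleᵇ : List ℕ → List ℕ → Bool
admissibleᵇ π D = avoids (D ++ reverse π) ρ312

admissibleCount : List ℕ → ℕ
admissibleCount π = length (filter (T? ∘ admissibleᵇ π) (tails π))

startsAscending : List ℕ → Bool
startsAscending (a ∷ b ∷ _) = a <ᵇ b
startsAscending _           = false

-- A good permutation never has exactly one admissible suffix; that count is sent to dead.
classify : ℕ → Bool → Class
classify 2 _                   = single
classify 3 true                = descent
classify (suc (suc (suc k))) _ = ascent (3 + k)
classify _ _                   = dead

goodClass : List ℕ → Class
goodClass π = classify (admissibleCount π) (startsAscending (reverse π))

classOf : List ℕ → Class
classOf π = if contains (π ++ reverse π) ρ1423 then bad else goodClass π

length-tails : ∀ (L : List X) → length (tails L) ≡ suc (length L)
length-tails []      = refl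
length-tails (_ ∷ L) = cong suc (length-tails L)

∈-tails⁻ : ∀ (L : List X) {D} → D ∈ tails L → ∃[ Z ] L ≡ Z ++ D
∈-tails⁻ []      (here refl) = [] , refl
∈-tails⁻ (y ∷ L) (here refl) = [] , refl
∈-tails⁻ (y ∷ L) (there D∈) with ∈-tails⁻ L D∈
... | Z , refl = y ∷ Z , refl

count-tails : ∀ (f : List X → Bool) P Q → (∀ {U y D} → P ≡ U ++ y ∷ D → ¬ T (f (y ∷ D ++ Q))) →
              (∀ {D} → D ∈ tails Q → T (f D)) → length (filter (T? ∘ f) (tails (P ++ Q))) ≡ suc (length Q)
count-tails f []      Q none all = trans (cong length (filter-all (T? ∘ f) (All.tabulate all))) (length-tails Q)
count-tails f (y ∷ P) Q none all =
  trans (cong length (filter-reject (T? ∘ f) (none {U = []} refl)))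
        (count-tails f P Q (λ {U} eq → none {U = y ∷ U} (cong (y ∷_) eq)) all)

admissibleCount-maximal : ∀ {π P Q} → MaxAdmissible π P Q → admissibleCount π ≡ suc (length Q)
admissibleCount-maximal {P = P} {Q} M with refl ← MaxAdmissible.split M =
  count-tails (admissibleᵇ (P ++ Q)) P Q (λ eq t → T-not⇒¬T t (contains312⁺ (maximal eq))) all
  where
    open MaxAdmissible M
    all : ∀ {D} → D ∈ tails Q → T (admissibleᵇ (P ++ Q) D)
    all D∈ with ∈-tails⁻ Q D∈
    ... | Z , refl = ¬T⇒T-not (admissible-suffix (P ++ Q) Z _ admissible ∘ contains312⁻)

admissibleCount-dead : ∀ π → Occ312 (reverse π) → admissibleCount π ≡ 0
admissibleCount-dead π occ = cong length (filter-none (T? ∘ admissibleᵇ π) (All.tabulate inadmissible))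
  where
    inadmissible : ∀ {D} → D ∈ tails π → ¬ T (admissibleᵇ π D)
    inadmissible {D} _ t = T-not⇒¬T t (contains312⁺ (Occ312-mono (++⁺ˡ D ⊆-refl) occ))

classOf-good : ∀ π {c d} → Good π → admissibleCount π ≡ c → startsAscending (reverse π) ≡ d → classOf π ≡ classify c d
classOf-good π g refl refl = cong (if_then bad else goodClass π) (Equivalence.to T-not-≡ (¬T⇒T-not (g ∘ contains1423⁻)))

startsAscending-reverse : ∀ {π} P u v → π ≡ P ++ u ∷ v ∷ [] → startsAscending (reverse π) ≡ (v <ᵇ u)
startsAscending-reverse P u v refl = cong startsAscending (reverse-++ P (u ∷ v ∷ []))

class-sound : ∀ {π k} → State π k → classOf π ≡ k
class-sound {π} (bad b) = cong (if_then bad else goodClass π) (Equivalence.to T-≡ (contains1423⁺ b))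
class-sound {π} (dead g occ) = classOf-good π g (admissibleCount-dead π occ) refl
class-sound {π} (single M) = classOf-good π (MaxAdmissible.good M) (admissibleCount-maximal M) refl
class-sound {π} (descent {P} {u} {v} v<u M) =
  classOf-good π (MaxAdmissible.good M) (admissibleCount-maximal M)
    (trans (startsAscending-reverse P u v (MaxAdmissible.split M)) (Equivalence.to T-≡ (<⇒<ᵇ v<u)))
class-sound {π} (ascent {P} {q} {[]} {l} q<l M) =
  classOf-good π (MaxAdmissible.good M) (admissibleCount-maximal M)
    (trans (startsAscending-reverse P q l (MaxAdmissible.split M)) (>⇒<ᵇ≡false q<l))
class-sound {π} (ascent {Q = _ ∷ Q} {l} q<l M) =
  classOf-good π (MaxAdmissible.good M)
    (trans (admissibleCount-maximal M) (cong (3 +_) (trans (length-++ Q) (+-comm (length Q) 1)))) refl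

record Tally : Set where
  constructor ⟨_,_,_,_,_⟩
  field goods singles descents ascents ascentSizes : ℕ
open Tally

infixr 6 _⊕_
_⊕_ : Tally → Tally → Tally
⟨ g , o , b , k , w ⟩ ⊕ ⟨ g′ , o′ , b′ , k′ , w′ ⟩ = ⟨ g + g′ , o + o′ , b + b′ , k + k′ , w + w′ ⟩

𝟘 : Tally
𝟘 = ⟨ 0 , 0 , 0 , 0 , 0 ⟩

tally : Class → Tally
tally bad        = 𝟘
tally dead       = ⟨ 1 , 0 , 0 , 0 , 0 ⟩
tally single     = ⟨ 1 , 1 , 0 , 0 , 0 ⟩
tally descent    = ⟨ 1 , 0 , 1 , 0 , 0 ⟩
tally (ascent c) = ⟨ 1 , 0 , 0 , 1 , c ⟩

-- Children of one permutation of each class: single ↦ ascent 3, descent;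
-- descent ↦ ascent 4, ascent 3, descent; ascent c ↦ ascent (c + 1), c − 2 dead ones, single.
step : Tally → Tally
step ⟨ g , o , b , k , w ⟩ = ⟨ 2 * o + 3 * b + w , k , o + b , o + 2 * b + k , 3 * o + 7 * b + w + k ⟩

tallyOf : List (List ℕ) → Tally
tallyOf = foldr (λ π t → tally (classOf π) ⊕ t) 𝟘

⟨⟩-cong : ∀ {g g′ o o′ b b′ k k′ w w′} → g ≡ g′ → o ≡ o′ → b ≡ b′ → k ≡ k′ → w ≡ w′ →
          ⟨ g , o , b , k , w ⟩ ≡ ⟨ g′ , o′ , b′ , k′ , w′ ⟩
⟨⟩-cong refl refl refl refl refl = refl

⊕-assoc : ∀ u v w → (u ⊕ v) ⊕ w ≡ u ⊕ (v ⊕ w)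
⊕-assoc ⟨ g , o , b , k , w ⟩ ⟨ g′ , o′ , b′ , k′ , w′ ⟩ ⟨ g″ , o″ , b″ , k″ , w″ ⟩ =
  ⟨⟩-cong (+-assoc g g′ g″) (+-assoc o o′ o″) (+-assoc b b′ b″) (+-assoc k k′ k″) (+-assoc w w′ w″)

step-⊕ : ∀ u v → step (u ⊕ v) ≡ step u ⊕ step v
step-⊕ ⟨ _ , o , b , k , w ⟩ ⟨ _ , o′ , b′ , k′ , w′ ⟩ = ⟨⟩-cong goods-eq refl descents-eq ascents-eq sizes-eq
  where
    vs = o ∷ b ∷ k ∷ w ∷ o′ ∷ b′ ∷ k′ ∷ w′ ∷ []
    goods-eq : 2 * (o + o′) + 3 * (b + b′) + (w + w′) ≡ (2 * o + 3 * b + w) + (2 * o′ + 3 * b′ + w′)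
    goods-eq = solve vs
    descents-eq : (o + o′) + (b + b′) ≡ (o + b) + (o′ + b′)
    descents-eq = solve vs
    ascents-eq : (o + o′) + 2 * (b + b′) + (k + k′) ≡ (o + 2 * b + k) + (o′ + 2 * b′ + k′)
    ascents-eq = solve vs
    sizes-eq : 3 * (o + o′) + 7 * (b + b′) + (w + w′) + (k + k′) ≡ (3 * o + 7 * b + w + k) + (3 * o′ + 7 * b′ + w′ + k′)
    sizes-eq = solve vs

tallyOf-++ : ∀ A B → tallyOf (A ++ B) ≡ tallyOf A ⊕ tallyOf B
tallyOf-++ []      B = refl
tallyOf-++ (π ∷ A) B = trans (cong (tally (classOf π) ⊕_) (tallyOf-++ A B)) (sym (⊕-assoc _ (tallyOf A) (tallyOf B)))

tallyOf-∷ : ∀ {σ k} L → State σ k → tallyOf (σ ∷ L) ≡ tally k ⊕ tallyOf L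
tallyOf-∷ L s = cong (λ c → tally c ⊕ tallyOf L) (class-sound s)

tallyOf-bad : ∀ L → (∀ {σ} → σ ∈ L → Bad σ) → tallyOf L ≡ 𝟘
tallyOf-bad []      _       = refl
tallyOf-bad (σ ∷ L) all-bad = trans (tallyOf-∷ {σ = σ} L (bad (all-bad (here refl)))) (tallyOf-bad L (λ σ∈ → all-bad (there σ∈)))

tallyOf-dead : ∀ L → (∀ {σ} → σ ∈ L → State σ dead) → tallyOf L ≡ ⟨ length L , 0 , 0 , 0 , 0 ⟩
tallyOf-dead []      _        = refl
tallyOf-dead (σ ∷ L) all-dead =
  trans (tallyOf-∷ L (all-dead (here refl))) (cong (tally dead ⊕_) (tallyOf-dead L (λ σ∈ → all-dead (there σ∈))))

Classified : List (List ℕ) → Set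
Classified L = ∀ {σ} → σ ∈ L → ∃[ k ] State σ k

insertions-maximal : ∀ {π P Q x t} → MaxAdmissible π P Q → All (x <_) π →
                     Classified (map (P ++_) (insertions x Q)) → tallyOf (map (P ++_) (insertions x Q)) ≡ t →
                     Classified (insertions x π) × tallyOf (insertions x π) ≡ t
insertions-maximal {P = P} {Q} {x} M x<π classified tally-eq
  with refl ← MaxAdmissible.split M rewrite insertions-++ x P Q =
  classified′ , trans (tallyOf-++ before inside) (trans (cong (_⊕ tallyOf inside) (tallyOf-bad before (prefix-insertion-bad M x<π))) tally-eq)
  where
    before = map (_++ Q) (insertionsBefore x P)
    inside = map (P ++_) (insertions x Q)
    classified′ : Classified (before ++ inside)
    classified′ σ∈ with ∈-++⁻ before σ∈
    ... | inj₁ σ∈′ = bad , bad (prefix-insertion-bad M x<π σ∈′)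
    ... | inj₂ σ∈′ = classified σ∈′

children-bad : ∀ {π x} → (∀ {U D σ} → π ≡ U ++ D → σ ≡ U ++ x ∷ D → Bad σ) →
               Classified (insertions x π) × tallyOf (insertions x π) ≡ 𝟘
children-bad {π} {x} bad-child = (λ σ∈ → bad , bad (child-bad σ∈)) , tallyOf-bad (insertions x π) child-bad
  where
    child-bad : ∀ {σ} → σ ∈ insertions x π → Bad σ
    child-bad σ∈ with ∈-insertions⁻ x π σ∈
    ... | _ , _ , π≡ , σ≡ = bad-child π≡ σ≡

children-single : ∀ {π P q x} → MaxAdmissible π P (q ∷ []) → All (x <_) π →
                  Classified (insertions x π) × tallyOf (insertions x π) ≡ step (tally single)
children-single {P = P} {q} {x} M x<π =
  insertions-maximal M x<π classified (trans (tallyOf-∷ ((P ++ q ∷ x ∷ []) ∷ []) front) (cong (tally (ascent 3) ⊕_) (tallyOf-∷ [] back)))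
  where
    x<q = All.lookup x<π (subst (q ∈_) (sym (MaxAdmissible.split M)) (∈-++⁺ʳ P (here refl)))
    front = ascent {Q = []} x<q (insert-front M x<π)
    back  = descent x<q (single-append M x<π)
    classified : Classified (map (P ++_) (insertions x (q ∷ [])))
    classified (here refl)         = -, front
    classified (there (here refl)) = -, back

children-descent : ∀ {π P u v x} → v < u → MaxAdmissible π P (u ∷ v ∷ []) → All (x <_) π →
                   Classified (insertions x π) × tallyOf (insertions x π) ≡ step (tally descent)
children-descent {P = P} {u} {v} {x} v<u M x<π =
  insertions-maximal M x<π classified
    (trans (tallyOf-∷ ((P ++ u ∷ x ∷ v ∷ []) ∷ (P ++ u ∷ v ∷ x ∷ []) ∷ []) front)
      (cong (tally (ascent 4) ⊕_)
        (trans (tallyOf-∷ ((P ++ u ∷ v ∷ x ∷ []) ∷ []) middle) (cong (tally (ascent 3) ⊕_) (tallyOf-∷ [] back)))))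
  where
    x<v = All.lookup x<π (subst (v ∈_) (sym (MaxAdmissible.split M)) (∈-++⁺ʳ P (there (here refl))))
    front  = ascent {Q = u ∷ []} x<v (insert-front M x<π)
    middle = ascent {Q = []} x<v (descent-insert-middle v<u M x<π)
    back   = descent x<v (descent-append v<u M x<π)
    classified : Classified (map (P ++_) (insertions x (u ∷ v ∷ [])))
    classified (here refl)                 = -, front
    classified (there (here refl))         = -, middle
    classified (there (there (here refl))) = -, back

ascent-children-tally : ∀ k → tally (ascent (4 + k)) ⊕ ⟨ suc k , 0 , 0 , 0 , 0 ⟩ ⊕ tally single ⊕ 𝟘 ≡ step (tally (ascent (3 + k)))
ascent-children-tally k = ⟨⟩-cong (cong (2 +_) (+-comm k 1)) refl refl refl (trans (+-identityʳ (4 + k)) (cong (3 +_) (+-comm 1 k)))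

children-ascent : ∀ {π P q Qm l x} → q < l → MaxAdmissible π P (q ∷ Qm ++ l ∷ []) → All (x <_) π →
                  Classified (insertions x π) × tallyOf (insertions x π) ≡ step (tally (ascent (3 + length Qm)))
children-ascent {P = P} {q} {Qm} {l} {x} q<l M x<π with refl ← MaxAdmissible.split M =
  insertions-maximal M x<π classified tally-eq
  where
    k = length Qm
    x<l = All.lookup x<π (∈-++⁺ʳ P (there (∈-++⁺ʳ Qm (here refl))))
    middles = map (λ τ → P ++ q ∷ τ ++ l ∷ []) (insertions x Qm)
    σ-back = P ++ q ∷ Qm ++ l ∷ x ∷ []
    front = ascent {Q = q ∷ Qm} x<l (insert-front M x<π)
    middle : ∀ {σ} → σ ∈ middles → State σ dead
    middle σ∈ with ∈-map⁻ (λ τ → P ++ q ∷ τ ++ l ∷ []) σ∈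
    ... | τ , τ∈ , refl with ∈-insertions⁻ x Qm τ∈
    ...   | U , D , Qm≡ , refl = ascent-insert-inside U D q<l M x<π Qm≡
    back = ascent-append q<l M x<π
    classified : Classified (map (P ++_) (insertions x (q ∷ Qm ++ l ∷ [])))
    classified (here refl) = -, front
    classified (there σ∈) with ∈-++⁻ middles (subst (_ ∈_) (ascent-insertions x P q Qm l) σ∈)
    ... | inj₁ σ∈′         = -, middle σ∈′
    ... | inj₂ (here refl) = -, back
    tally-eq : tallyOf (map (P ++_) (insertions x (q ∷ Qm ++ l ∷ []))) ≡ step (tally (ascent (3 + k)))
    tally-eq = begin
      tallyOf (map (P ++_) (insertions x (q ∷ Qm ++ l ∷ [])))
        ≡⟨ tallyOf-∷ (map (P ++_) (map (q ∷_) (insertions x (Qm ++ l ∷ [])))) front ⟩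
      tally (ascent (4 + k)) ⊕ tallyOf (map (P ++_) (map (q ∷_) (insertions x (Qm ++ l ∷ []))))
        ≡⟨ cong (λ L → tally (ascent (4 + k)) ⊕ tallyOf L) (ascent-insertions x P q Qm l) ⟩
      tally (ascent (4 + k)) ⊕ tallyOf (middles ++ σ-back ∷ [])
        ≡⟨ cong (tally (ascent (4 + k)) ⊕_) (tallyOf-++ middles (σ-back ∷ [])) ⟩
      tally (ascent (4 + k)) ⊕ tallyOf middles ⊕ tallyOf (σ-back ∷ [])
        ≡⟨ cong₂ (λ t t′ → tally (ascent (4 + k)) ⊕ t ⊕ t′) (tallyOf-dead middles middle) (tallyOf-∷ [] back) ⟩
      tally (ascent (4 + k)) ⊕ ⟨ length middles , 0 , 0 , 0 , 0 ⟩ ⊕ tally single ⊕ 𝟘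
        ≡⟨ cong (λ n → tally (ascent (4 + k)) ⊕ ⟨ n , 0 , 0 , 0 , 0 ⟩ ⊕ tally single ⊕ 𝟘)
                (trans (length-map _ (insertions x Qm)) (length-insertions x Qm)) ⟩
      tally (ascent (4 + k)) ⊕ ⟨ suc k , 0 , 0 , 0 , 0 ⟩ ⊕ tally single ⊕ 𝟘
        ≡⟨ ascent-children-tally k ⟩
      step (tally (ascent (3 + k))) ∎

children : ∀ {π k x} → State π k → All (x <_) π → Classified (insertions x π) × tallyOf (insertions x π) ≡ step (tally k)
children (bad b)         x<π = children-bad (λ {U} {D} π≡ σ≡ → bad-insert U D π≡ σ≡ b)
children (dead _ occ)    x<π =
  children-bad (λ {U} {D} π≡ σ≡ → inadmissible-insert U D π≡ σ≡ x<π (Occ312-mono (++⁺ˡ D ⊆-refl) occ))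
children (single M)      x<π = children-single M x<π
children (descent v<u M) x<π = children-descent v<u M x<π
children (ascent q<l M)  x<π = children-ascent q<l M x<π

tallyAfter : ℕ → Tally
tallyAfter zero    = tally single
tallyAfter (suc n) = step (tallyAfter n)

tallyOf-concatMap : ∀ (f : List ℕ → List (List ℕ)) L → (∀ {π} → π ∈ L → tallyOf (f π) ≡ step (tally (classOf π))) →
                    tallyOf (concatMap f L) ≡ step (tallyOf L)
tallyOf-concatMap f []      _    = refl
tallyOf-concatMap f (π ∷ L) eqs = begin
  tallyOf (f π ++ concatMap f L)                 ≡⟨ tallyOf-++ (f π) (concatMap f L) ⟩
  tallyOf (f π) ⊕ tallyOf (concatMap f L)        ≡⟨ cong₂ _⊕_ (eqs (here refl)) (tallyOf-concatMap f L (λ π∈ → eqs (there π∈))) ⟩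
  step (tally (classOf π)) ⊕ step (tallyOf L)    ≡⟨ sym (step-⊕ (tally (classOf π)) (tallyOf L)) ⟩
  step (tally (classOf π) ⊕ tallyOf L)           ∎

permsOf-tally : ∀ x xs → AllPairs _<_ (x ∷ xs) → Classified (permsOf (x ∷ xs)) × tallyOf (permsOf (x ∷ xs)) ≡ tallyAfter (length xs)
permsOf-tally x [] _ = (λ { (here refl) → -, single (singleton-maximal x) }) , tallyOf-∷ [] (single (singleton-maximal x))
permsOf-tally x (y ∷ ys) (x<xs ∷ increasing) with permsOf-tally y ys increasing
... | classified , tally-eq = classified′ , trans (tallyOf-concatMap (insertions x) (permsOf (y ∷ ys)) child-tally) (cong step tally-eq)
  where
    x<π : ∀ {π} → π ∈ permsOf (y ∷ ys) → All (x <_) π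
    x<π π∈ = All-resp-↭ (↭-sym (∈-permsOf⇒↭ (y ∷ ys) π∈)) x<xs
    classified′ : Classified (permsOf (x ∷ y ∷ ys))
    classified′ σ∈ with find (∈-concatMap⁻ (insertions x) {xs = permsOf (y ∷ ys)} σ∈)
    ... | π , π∈ , σ∈π = proj₁ (children (proj₂ (classified π∈)) (x<π π∈)) σ∈π
    child-tally : ∀ {π} → π ∈ permsOf (y ∷ ys) → tallyOf (insertions x π) ≡ step (tally (classOf π))
    child-tally π∈ with classified π∈
    ... | k , s = trans (proj₂ (children s (x<π π∈))) (cong (step ∘ tally) (sym (class-sound s)))

-- Counting and the recurrence

goods-classify : ∀ c d → goods (tally (classify c d)) ≡ 1
goods-classify 0                            _     = refl
goods-classify 1                            _     = refl
goods-classify 2                            _     = refl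
goods-classify 3                            true  = refl
goods-classify 3                            false = refl
goods-classify (suc (suc (suc (suc _)))) _     = refl

avoiderCount : List (List ℕ) → ℕ
avoiderCount L = length (filter (λ w → T? (avoids w ρ1423)) (map (λ π → π ++ reverse π) L))

avoiderCount≡goods : ∀ L → avoiderCount L ≡ goods (tallyOf L)
avoiderCount≡goods []      = refl
avoiderCount≡goods (π ∷ L) with contains (π ++ reverse π) ρ1423
... | true  = avoiderCount≡goods L
... | false = cong₂ _+_ (sym (goods-classify (admissibleCount π) (startsAscending (reverse π)))) (avoiderCount≡goods L)

oneTo≡applyUpTo : ∀ n → oneTo n ≡ applyUpTo suc n
oneTo≡applyUpTo zero    = refl
oneTo≡applyUpTo (suc n) = trans (cong (_++ suc n ∷ []) (oneTo≡applyUpTo n)) (applyUpTo-∷ʳ suc n)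

r≡goods : ∀ n → r (suc n) ρ1423 ≡ goods (tallyAfter n)
r≡goods n = begin
  avoiderCount (permsOf (oneTo (suc n)))            ≡⟨ cong (avoiderCount ∘ permsOf) (oneTo≡applyUpTo (suc n)) ⟩
  avoiderCount (permsOf (1 ∷ rest))                 ≡⟨ avoiderCount≡goods (permsOf (1 ∷ rest)) ⟩
  goods (tallyOf (permsOf (1 ∷ rest)))              ≡⟨ cong goods (proj₂ (permsOf-tally 1 rest increasing)) ⟩
  goods (tallyAfter (length rest))                  ≡⟨ cong (goods ∘ tallyAfter) (length-applyUpTo (suc ∘ suc) n) ⟩
  goods (tallyAfter n)                              ∎
  where
    rest = applyUpTo (suc ∘ suc) n
    increasing : AllPairs _<_ (1 ∷ rest)
    increasing = applyUpTo⁺₁ suc (suc n) (λ i<j _ → s≤s i<j)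

Balanced₁ Balanced₂ : Tally → Set
Balanced₁ t = goods t + 3 * ascents t ≡ 2 * singles t + 2 * descents t + ascentSizes t
Balanced₂ t = 4 * singles t + 3 * descents t + 4 * ascents t ≡ goods t + ascentSizes t + 2

step-balanced₁ : ∀ t → Balanced₁ (step t)
step-balanced₁ ⟨ _ , o , b , k , w ⟩ = identity
  where
    vs = o ∷ b ∷ k ∷ w ∷ []
    identity : (2 * o + 3 * b + w) + 3 * (o + 2 * b + k) ≡ 2 * k + 2 * (o + b) + (3 * o + 7 * b + w + k)
    identity = solve vs

step-balanced₂ : ∀ t → Balanced₁ t → Balanced₂ t → Balanced₂ (step t)
step-balanced₂ ⟨ g , o , b , k , w ⟩ h₁ h₂ = begin
  4 * k + 3 * (o + b) + 4 * (o + 2 * b + k)         ≡⟨ solve vs ⟩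
  (5 * o + 10 * b + k) + (2 * o + b + 7 * k)        ≡⟨ cong (5 * o + 10 * b + k +_) key ⟩
  (5 * o + 10 * b + k) + (2 * w + 2)                ≡⟨ solve vs ⟩
  (2 * o + 3 * b + w) + (3 * o + 7 * b + w + k) + 2 ∎
  where
    vs = g ∷ o ∷ b ∷ k ∷ w ∷ []
    key : 2 * o + b + 7 * k ≡ 2 * w + 2
    key = +-cancelˡ-≡ (g + 2 * o + 2 * b) _ _ (begin
      (g + 2 * o + 2 * b) + (2 * o + b + 7 * k)   ≡⟨ solve vs ⟩
      (g + 3 * k) + (4 * o + 3 * b + 4 * k)       ≡⟨ cong₂ _+_ h₁ h₂ ⟩
      (2 * o + 2 * b + w) + (g + w + 2)           ≡⟨ solve vs ⟩
      (g + 2 * o + 2 * b) + (2 * w + 2)           ∎)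

tallyAfter-balanced : ∀ n → Balanced₂ (tallyAfter (suc n))
tallyAfter-balanced zero    = refl
tallyAfter-balanced (suc n) = step-balanced₂ (tallyAfter (suc n)) (step-balanced₁ (tallyAfter n)) (tallyAfter-balanced n)

goods-recurrence : ∀ t → Balanced₂ t → goods (step (step (step t))) ≡ 2 * goods (step (step t)) + goods t + 2
goods-recurrence ⟨ g , o , b , k , w ⟩ h = begin
  2 * (o + 2 * b + k) + 3 * (k + (o + b)) + (3 * k + 7 * (o + b) + (3 * o + 7 * b + w + k) + (o + 2 * b + k))
                                                          ≡⟨ solve vs ⟩
  (12 * o + 20 * b + 6 * k + w) + (4 * o + 3 * b + 4 * k) ≡⟨ cong (12 * o + 20 * b + 6 * k + w +_) h ⟩
  (12 * o + 20 * b + 6 * k + w) + (g + w + 2)             ≡⟨ solve vs ⟩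
  2 * (2 * k + 3 * (o + b) + (3 * o + 7 * b + w + k)) + g + 2 ∎
  where vs = g ∷ o ∷ b ∷ k ∷ w ∷ []

theorem12 : (n : ℕ) → 5 ≤ n →
    r n (1 ∷ 4 ∷ 2 ∷ 3 ∷ []) ≡ 2 * r (n ∸ 1) (1 ∷ 4 ∷ 2 ∷ 3 ∷ []) + r (n ∸ 3) (1 ∷ 4 ∷ 2 ∷ 3 ∷ []) + 2
theorem12 _ (s≤s (s≤s (s≤s (s≤s (s≤s {n = m} z≤n))))) = begin
  r (5 + m) ρ1423                                                ≡⟨ r≡goods (4 + m) ⟩
  goods (tallyAfter (4 + m))                                     ≡⟨ goods-recurrence (tallyAfter (1 + m)) (tallyAfter-balanced m) ⟩
  2 * goods (tallyAfter (3 + m)) + goods (tallyAfter (1 + m)) + 2 ≡⟨ cong₂ (λ a b → 2 * a + b + 2) (r≡goods (3 + m)) (r≡goods (1 + m)) ⟨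
  2 * r (4 + m) ρ1423 + r (2 + m) ρ1423 + 2                       ∎
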